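{- Assume that $\mathcal{Z}$ is a Dedekind domain or a near UFD. Let $P(\underline{T},\underline{Y}) \in \mathcal{Z}[\underline{T},\underline{Y}]$ be a nonzero polynomial. Then there exists a nonzero element $\varphi \in \mathcal{Z}$ such that $P$ has no fixed divisors w.r.t. $\underline{T}$ among the proper principal ideals of $\mathcal{Z}[1/\varphi]$.
   Context: $\mathcal{Z}$ is an integral domain, $\underline{T}=(T_1,\dots,T_k)$ and $\underline{Y}=(Y_1,\dots,Y_n)$ are tuples of indeterminates. For an integral domain $R$ and $P\in R[\underline T,\underline Y]$, a proper ideal $\mathfrak{p}\subset R$ is a fixed divisor of $P$ w.r.t. $\underline T$ if $P(\underline t,\underline Y)\equiv 0 \pmod{\mathfrak{p}}$ for every $\underline t\in R^k$. A near UFD is an integral domain in which every nonzero element has finitely many prime divisors (modulo units) and every nonunit has at least one prime divisor. -}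

module Defs where

open import Level using (Level; _⊔_; suc; Lift)
open import Algebra.Bundles using (CommutativeRing)
open import Data.Nat as ℕ using (ℕ; zero) renaming (suc to sucℕ)
open import Data.Fin using (Fin)
open import Data.Vec using (Vec; []; _∷_; lookup)
open import Data.List using (List; []; _∷_; upTo; foldr; map)
open import Data.List.Relation.Unary.Any using (Any)
open import Data.Product using (Σ; ∃; ∃-syntax; _×_; _,_)
open import Data.Sum using (_⊎_)
open import Relation.Nullary using (¬_)

module _ {c ℓ : Level} (R : CommutativeRing c ℓ) where
  open CommutativeRing R

  infixr 8 _^ᴿ_
  _^ᴿ_ : Carrier → ℕ → Carrier
  x ^ᴿ zero = 1#
  x ^ᴿ sucℕ n = x * (x ^ᴿ n)

  Divides : Carrier → Carrier → Set (c ⊔ ℓ)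
  Divides a b = ∃[ q ] (b ≈ q * a)

  IsUnit : Carrier → Set (c ⊔ ℓ)
  IsUnit u = ∃[ v ] (u * v ≈ 1#)

  Associated : Carrier → Carrier → Set (c ⊔ ℓ)
  Associated a b = ∃[ u ] (IsUnit u × b ≈ u * a)

  IsIntegralDomain : Set (c ⊔ ℓ)
  IsIntegralDomain = (¬ (1# ≈ 0#)) × (∀ x y → x * y ≈ 0# → (x ≈ 0#) ⊎ (y ≈ 0#))

  IsPrimeElement : Carrier → Set (c ⊔ ℓ)
  IsPrimeElement p = (¬ (p ≈ 0#)) × (¬ IsUnit p) ×
                     (∀ a b → Divides p (a * b) → Divides p a ⊎ Divides p b)

  -- Near UFD: every nonzero element has finitely many prime divisors
  -- (modulo units: all of them are associated to one of a finite list),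
  -- and every nonunit has at least one prime divisor.
  IsNearUFD : Set (c ⊔ ℓ)
  IsNearUFD = IsIntegralDomain ×
    ((∀ x → ¬ (x ≈ 0#) →
        ∃[ ps ] (∀ p → IsPrimeElement p → Divides p x →
                   Any (Associated p) ps)) ×
     (∀ x → ¬ IsUnit x → ∃[ p ] (IsPrimeElement p × Divides p x)))

  record Ideal : Set (suc (c ⊔ ℓ)) where
    field
      member  : Carrier → Set (c ⊔ ℓ)
      resp    : ∀ {x y} → x ≈ y → member x → member y
      zero∈   : member 0#
      +-closed : ∀ {x y} → member x → member y → member (x + y)
      *-closed : ∀ r {x} → member x → member (r * x)
  open Ideal public

  _⊆ᴵ_ : Ideal → Ideal → Set (c ⊔ ℓ)
  I ⊆ᴵ J = ∀ x → member I x → member J x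

  IsProperIdeal : Ideal → Set (c ⊔ ℓ)
  IsProperIdeal I = ¬ member I 1#

  IsPrimeIdeal : Ideal → Set (c ⊔ ℓ)
  IsPrimeIdeal I = IsProperIdeal I ×
    (∀ a b → member I (a * b) → member I a ⊎ member I b)

  IsMaximalIdeal : Ideal → Set (suc (c ⊔ ℓ))
  IsMaximalIdeal I = IsProperIdeal I ×
    (∀ J → I ⊆ᴵ J → (J ⊆ᴵ I) ⊎ member J 1#)

  IsZeroIdeal : Ideal → Set (c ⊔ ℓ)
  IsZeroIdeal I = ∀ x → member I x → x ≈ 0#

  InSpan : List Carrier → Carrier → Set (c ⊔ ℓ)
  InSpan [] x = Lift c (x ≈ 0#)
  InSpan (g ∷ gs) x = ∃[ r ] ∃[ y ] (InSpan gs y × x ≈ r * g + y)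

  IsFinitelyGenerated : Ideal → Set (c ⊔ ℓ)
  IsFinitelyGenerated I = ∃[ gs ] (∀ x → (member I x → InSpan gs x) × (InSpan gs x → member I x))

  IsNoetherian : Set (suc (c ⊔ ℓ))
  IsNoetherian = ∀ I → IsFinitelyGenerated I

  integralEqTail : List Carrier → Carrier → Carrier → ℕ → ℕ → Carrier
  integralEqTail [] a b i n = 0#
  integralEqTail (cᵢ ∷ cs) a b i n = cᵢ * (a ^ᴿ i) * (b ^ᴿ (n ℕ.∸ i)) + integralEqTail cs a b (sucℕ i) n

  -- Integrally closed (in the fraction field): if a/b (b ≠ 0) is a root of a monic
  -- polynomial X^n + c_{n-1} X^{n-1} + … + c_0 over R, i.e.
  -- a^n + Σ_{i<n} c_i a^i b^{n-i} = 0, then a/b ∈ R, i.e. b ∣ a.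
  IsIntegrallyClosed : Set (c ⊔ ℓ)
  IsIntegrallyClosed = ∀ (a b : Carrier) (cs : List Carrier) → ¬ (b ≈ 0#) →
    (a ^ᴿ Data.List.length cs) + integralEqTail cs a b 0 (Data.List.length cs) ≈ 0# →
    Divides b a

  -- Dedekind domain: Noetherian integrally closed domain of Krull dimension one
  -- (every nonzero prime ideal is maximal, and the domain is not a field).
  IsDedekindDomain : Set (suc (c ⊔ ℓ))
  IsDedekindDomain = IsIntegralDomain × IsNoetherian × IsIntegrallyClosed ×
    (∀ I → IsPrimeIdeal I → ¬ IsZeroIdeal I → IsMaximalIdeal I) ×
    (∃[ x ] ((¬ (x ≈ 0#)) × ¬ IsUnit x))

  -- Polynomials in 𝒵[T₁..T_k, Y₁..Y_n]: coefficient function on pairs of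
  -- exponent vectors, with all exponents bounded by `bound`.
  record Poly₂ (k n : ℕ) : Set (c ⊔ ℓ) where
    field
      coeff  : Vec ℕ k → Vec ℕ n → Carrier
      bound  : ℕ
      vanish : ∀ α β → ((∃[ i ] bound ℕ.< lookup α i) ⊎ (∃[ j ] bound ℕ.< lookup β j)) →
               coeff α β ≈ 0#
  open Poly₂ public

  IsNonzeroPoly : ∀ {k n} → Poly₂ k n → Set ℓ
  IsNonzeroPoly P = ∃[ α ] ∃[ β ] ¬ (coeff P α β ≈ 0#)

  -- The localization 𝒵[1/φ]: elements a/φ^m represented by pairs (a , m),
  -- with the usual operations and equality a/φ^m = b/φ^l ⇔ a φ^l = b φ^m.
  module Localization (φ : Carrier) where
    Loc : Set c
    Loc = Carrier × ℕ

    _≈ₗ_ : Loc → Loc → Set ℓ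
    (a , m) ≈ₗ (b , l) = a * (φ ^ᴿ l) ≈ b * (φ ^ᴿ m)

    _+ₗ_ : Loc → Loc → Loc
    (a , m) +ₗ (b , l) = (a * (φ ^ᴿ l) + b * (φ ^ᴿ m) , m ℕ.+ l)

    _*ₗ_ : Loc → Loc → Loc
    (a , m) *ₗ (b , l) = (a * b , m ℕ.+ l)

    0ₗ 1ₗ : Loc
    0ₗ = (0# , 0)
    1ₗ = (1# , 0)

    ι : Carrier → Loc
    ι a = (a , 0)

    _^ₗ_ : Loc → ℕ → Loc
    x ^ₗ zero = 1ₗ
    x ^ₗ sucℕ e = x *ₗ (x ^ₗ e)

    Dividesₗ : Loc → Loc → Set (c ⊔ ℓ)
    Dividesₗ x y = ∃[ q ] (y ≈ₗ (q *ₗ x))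

    IsUnitₗ : Loc → Set (c ⊔ ℓ)
    IsUnitₗ x = ∃[ y ] ((x *ₗ y) ≈ₗ 1ₗ)

    monomial : ∀ {k} → Vec Loc k → Vec ℕ k → Loc
    monomial [] [] = 1ₗ
    monomial (t ∷ ts) (e ∷ es) = (t ^ₗ e) *ₗ monomial ts es

    boxSum : (D k : ℕ) → (Vec ℕ k → Loc) → Loc
    boxSum D zero f = f []
    boxSum D (sucℕ k) f = foldr _+ₗ_ 0ₗ (map (λ i → boxSum D k (λ v → f (i ∷ v))) (upTo (sucℕ D)))

    specCoeff : ∀ {k n} → Poly₂ k n → Vec Loc k → Vec ℕ n → Loc
    specCoeff P t β = boxSum (bound P) _ (λ α → ι (coeff P α β) *ₗ monomial t α)

    -- The principal ideal (x) of 𝒵[1/φ] is a fixed divisor of P w.r.t. T: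
    -- P(t, Y) ≡ 0 mod (x) for all t ∈ 𝒵[1/φ]^k, i.e. x divides every
    -- coefficient of P(t, Y).
    IsFixedDivisorPrincipal : ∀ {k n} → Poly₂ k n → Loc → Set (c ⊔ ℓ)
    IsFixedDivisorPrincipal P x = ∀ t β → Dividesₗ x (specCoeff P t β)

  open Localization public

{-# OPTIONS --safe #-}

-- A domain that is Dedekind or a near UFD has a nonzero nonunit s, and its powers 1, s, s², …
-- are pairwise distinct. Using them as interpolation nodes in each variable, for every exponent
-- α₀ in the box {0..D}ᵏ there is a nonzero K such that K·c_α₀ is a 𝒵-linear combination of the
-- values Σ_α c_α tᵅ at points t ∈ 𝒵ᵏ, uniformly in the coefficients c. Take φ = K·c_α₀β₀ for a
-- nonzero coefficient of P. A principal fixed divisor (x) of P in 𝒵[1/φ] divides the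
-- Y^β₀-coefficient of P(t, Y) at every t ∈ 𝒵ᵏ, hence divides φ, a unit of 𝒵[1/φ].

module Submission where

open import Defs hiding (Loc; _+ₗ_; _*ₗ_; 0ₗ; ι; _^ₗ_; Dividesₗ; monomial; boxSum; specCoeff)
open import Level using (Level; _⊔_)
open import Algebra.Bundles using (CommutativeRing)
open import Data.Nat as ℕ using (ℕ; zero; suc; _≤_; s≤s; _≟_)
open import Data.Nat.Properties using (≮⇒≥)
open import Data.Product using (∃-syntax; _×_; _,_; proj₁; proj₂)
open import Data.Sum using (_⊎_; inj₁; inj₂; [_,_])
open import Data.Vec using (Vec; []; _∷_; lookup)
import Data.Vec as Vec
open import Data.Fin using () renaming (zero to fzero; suc to fsuc)
open import Data.List using (List; []; _∷_; foldr; map; upTo; filter)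
open import Data.List.Membership.Propositional using (_∈_)
open import Data.List.Membership.Propositional.Properties using (∈-upTo⁺; ∈-filter⁺; ∈-filter⁻)
open import Data.List.Relation.Unary.Any using (here; there)
open import Data.List.Relation.Unary.All using () renaming (lookup to lookupᴬ)
open import Data.List.Relation.Unary.AllPairs using (_∷_)
open import Data.List.Relation.Unary.Unique.Propositional using (Unique)
open import Data.List.Relation.Unary.Unique.Propositional.Properties using (upTo⁺)
open import Data.Empty using (⊥-elim)
open import Function using (_∘_; id)
import Relation.Binary.PropositionalEquality as ≡
open ≡ using (_≡_; _≢_)
open import Relation.Nullary using (¬_; ¬?; Dec)

module _ {c ℓ : Level} (𝒵 : CommutativeRing c ℓ) where
  open CommutativeRing 𝒵 renaming (Carrier to Z)
  open import Algebra.Properties.CommutativeSemiring.Exp commutativeSemiring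
    using (_^_; ^-homo-*; ^-distrib-*)
  open import Algebra.Properties.CommutativeSemigroup *-commutativeSemigroup
    using (x∙yz≈y∙xz; x∙yz≈xz∙y; xy∙z≈x∙zy)
  open import Algebra.Properties.Ring ring using (x[y-z]≈xy-xz)
  open import Algebra.Properties.AbelianGroup +-abelianGroup using (x∙y⁻¹≈ε⇒x≈y)
  open import Algebra.Solver.Ring.NaturalCoefficients.Default commutativeSemiring
  open import Relation.Binary.Reasoning.Setoid setoid

  ^ᴿ≈^ : ∀ x n → _^ᴿ_ 𝒵 x n ≈ x ^ n
  ^ᴿ≈^ x zero    = refl
  ^ᴿ≈^ x (suc n) = *-congˡ (^ᴿ≈^ x n)

  1^n≈1 : ∀ n → 1# ^ n ≈ 1#
  1^n≈1 zero    = refl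
  1^n≈1 (suc n) = trans (*-identityˡ _) (1^n≈1 n)

  data Span {A : Set c} (g : A → Z) : Z → Set (c ⊔ ℓ) where
    gen       : ∀ t → Span g (g t)
    span-resp : ∀ {x y} → x ≈ y → Span g x → Span g y
    span-0#   : Span g 0#
    span-+    : ∀ {x y} → Span g x → Span g y → Span g (x + y)
    span-*    : ∀ r {x} → Span g x → Span g (r * x)

  span : {A : Set c} → (A → Z) → Ideal 𝒵
  span g = record
    { member   = Span g
    ; resp     = span-resp
    ; zero∈    = span-0#
    ; +-closed = span-+
    ; *-closed = span-*
    }

  span-minimal : ∀ {A : Set c} {g : A → Z} (I : Ideal 𝒵) →
                 (∀ t → member I (g t)) → ∀ {z} → Span g z → member I z
  span-minimal I g∈I (gen t)           = g∈I t
  span-minimal I g∈I (span-resp x≈y s) = resp I x≈y (span-minimal I g∈I s)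
  span-minimal I g∈I span-0#           = zero∈ I
  span-minimal I g∈I (span-+ s₁ s₂)    = +-closed I (span-minimal I g∈I s₁) (span-minimal I g∈I s₂)
  span-minimal I g∈I (span-* r s)      = *-closed I r (span-minimal I g∈I s)

  infixl 7 _∶_
  _∶_ : Ideal 𝒵 → Z → Ideal 𝒵
  I ∶ r = record
    { member   = λ z → member I (r * z)
    ; resp     = λ x≈y → resp I (*-congˡ x≈y)
    ; zero∈    = resp I (sym (zeroʳ r)) (zero∈ I)
    ; +-closed = λ x∈ y∈ → resp I (sym (distribˡ r _ _)) (+-closed I x∈ y∈)
    ; *-closed = λ s x∈ → resp I (x∙yz≈y∙xz s r _) (*-closed I s x∈)
    }

  nonzero-nonunit : IsDedekindDomain 𝒵 ⊎ IsNearUFD 𝒵 →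
                    IsIntegralDomain 𝒵 × ∃[ s ] (¬ s ≈ 0#) × ¬ IsUnit 𝒵 s
  nonzero-nonunit (inj₁ (dom , _ , _ , _ , s , s≉0 , s∤1)) = dom , s , s≉0 , s∤1
  nonzero-nonunit (inj₂ (dom , _ , has-prime-divisor))
    with has-prime-divisor 0# (λ (v , 0v≈1) → proj₁ dom (trans (sym 0v≈1) (zeroˡ v)))
  ... | p , (p≉0 , p∤1 , _) , _ = dom , p , p≉0 , p∤1

  module IntegralDomain (dom : IsIntegralDomain 𝒵) where

    *-nonzero : ∀ {x y} → ¬ x ≈ 0# → ¬ y ≈ 0# → ¬ x * y ≈ 0#
    *-nonzero x≉0 y≉0 xy≈0 = [ x≉0 , y≉0 ] (proj₂ dom _ _ xy≈0)

    *-cancelˡ : ∀ {s x y} → ¬ s ≈ 0# → s * x ≈ s * y → x ≈ y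
    *-cancelˡ {s} {x} {y} s≉0 sx≈sy =
      x∙y⁻¹≈ε⇒x≈y x y ([ ⊥-elim ∘ s≉0 , id ] (proj₂ dom s (x - y) s[x-y]≈0))
      where
      s[x-y]≈0 : s * (x - y) ≈ 0#
      s[x-y]≈0 = trans (x[y-z]≈xy-xz s x y) (trans (+-congʳ sx≈sy) (-‿inverseʳ (s * y)))

    ^-injective : ∀ {s} → ¬ s ≈ 0# → ¬ IsUnit 𝒵 s → ∀ m n → s ^ m ≈ s ^ n → m ≡ n
    ^-injective s≉0 s∤1 zero    zero    _ = ≡.refl
    ^-injective s≉0 s∤1 zero    (suc n) 1≈sⁿ⁺¹ = ⊥-elim (s∤1 (_ , sym 1≈sⁿ⁺¹))
    ^-injective s≉0 s∤1 (suc m) zero    sᵐ⁺¹≈1 = ⊥-elim (s∤1 (_ , sᵐ⁺¹≈1))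
    ^-injective s≉0 s∤1 (suc m) (suc n) e =
      ≡.cong suc (^-injective s≉0 s∤1 m n (*-cancelˡ s≉0 e))

  sumOver : List ℕ → (ℕ → Z) → Z
  sumOver ns f = foldr _+_ 0# (map f ns)

  sumOver-cong : ∀ ns {f g : ℕ → Z} → (∀ i → f i ≈ g i) → sumOver ns f ≈ sumOver ns g
  sumOver-cong []       f≈g = refl
  sumOver-cong (i ∷ ns) f≈g = +-cong (f≈g i) (sumOver-cong ns f≈g)

  *-distribʳ-sumOver : ∀ ns f r → sumOver ns (λ i → f i * r) ≈ sumOver ns f * r
  *-distribʳ-sumOver []       f r = sym (zeroˡ r)
  *-distribʳ-sumOver (i ∷ ns) f r =
    trans (+-congˡ (*-distribʳ-sumOver ns f r)) (sym (distribʳ r (f i) _))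

  sumOver-zero : ∀ ns f → (∀ {i} → i ∈ ns → f i ≈ 0#) → sumOver ns f ≈ 0#
  sumOver-zero []       f f≈0 = refl
  sumOver-zero (i ∷ ns) f f≈0 =
    trans (+-cong (f≈0 (here ≡.refl)) (sumOver-zero ns f (f≈0 ∘ there))) (+-identityˡ 0#)

  sumOver-single : ∀ {ns f i₀} → Unique ns → i₀ ∈ ns →
                   (∀ {i} → i ∈ ns → i ≢ i₀ → f i ≈ 0#) → sumOver ns f ≈ f i₀
  sumOver-single {i ∷ ns} {f} (i∉ns ∷ _) (here ≡.refl) f≈0 =
    trans (+-congˡ (sumOver-zero ns f (λ j∈ns → f≈0 (there j∈ns) (lookupᴬ i∉ns j∈ns ∘ ≡.sym))))
          (+-identityʳ _)
  sumOver-single {i ∷ ns} (i∉ns ∷ unique) (there i₀∈ns) f≈0 =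
    trans (+-congʳ (f≈0 (here ≡.refl) (lookupᴬ i∉ns i₀∈ns)))
          (trans (+-identityˡ _) (sumOver-single unique i₀∈ns (f≈0 ∘ there)))

  evalUni : List ℕ → (ℕ → Z) → Z → Z
  evalUni ns a u = sumOver ns (λ i → a i * u ^ i)

  evalUni-cong : ∀ ns {a b} u → (∀ i → a i ≈ b i) → evalUni ns a u ≈ evalUni ns b u
  evalUni-cong ns u a≈b = sumOver-cong ns (λ i → *-congʳ (a≈b i))

  evalUni-dilate : ∀ ns a x u r →
    evalUni ns a (x * u) + r * evalUni ns a u ≈ evalUni ns (λ i → a i * (x ^ i + r)) u
  evalUni-dilate []       a x u r = trans (+-identityˡ _) (zeroʳ r)
  evalUni-dilate (i ∷ ns) a x u r = begin
    (a i * (x * u) ^ i + F[xu]) + r * (a i * u ^ i + F[u])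
      ≈⟨ +-congʳ (+-congʳ (*-congˡ (^-distrib-* x u i))) ⟩
    (a i * (x ^ i * u ^ i) + F[xu]) + r * (a i * u ^ i + F[u])
      ≈⟨ regroup (a i) (x ^ i) (u ^ i) r F[xu] F[u] ⟩
    a i * (x ^ i + r) * u ^ i + (F[xu] + r * F[u])
      ≈⟨ +-congˡ (evalUni-dilate ns a x u r) ⟩
    evalUni (i ∷ ns) (λ j → a j * (x ^ j + r)) u ∎
    where
    F[xu] F[u] : Z
    F[xu] = evalUni ns a (x * u)
    F[u]  = evalUni ns a u
    regroup : ∀ A X U r P Q →
      (A * (X * U) + P) + r * (A * U + Q) ≈ A * (X + r) * U + (P + r * Q)
    regroup = solve 6 (λ A X U r P Q →
      (A :* (X :* U) :+ P) :+ r :* (A :* U :+ Q) := A :* (X :+ r) :* U :+ (P :+ r :* Q)) refl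

  monomialZ : ∀ {k} → Vec Z k → Vec ℕ k → Z
  monomialZ []       []       = 1#
  monomialZ (t ∷ ts) (e ∷ es) = t ^ e * monomialZ ts es

  boxSumZ : (D k : ℕ) → (Vec ℕ k → Z) → Z
  boxSumZ D zero    f = f []
  boxSumZ D (suc k) f = sumOver (upTo (suc D)) (λ i → boxSumZ D k (λ α → f (i ∷ α)))

  boxSumZ-cong : ∀ D k {f g : Vec ℕ k → Z} → (∀ α → f α ≈ g α) → boxSumZ D k f ≈ boxSumZ D k g
  boxSumZ-cong D zero    f≈g = f≈g []
  boxSumZ-cong D (suc k) f≈g = sumOver-cong (upTo (suc D)) (λ i → boxSumZ-cong D k (f≈g ∘ (i ∷_)))

  *-distribʳ-boxSumZ : ∀ D k f r → boxSumZ D k (λ α → f α * r) ≈ boxSumZ D k f * r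
  *-distribʳ-boxSumZ D zero    f r = refl
  *-distribʳ-boxSumZ D (suc k) f r =
    trans (sumOver-cong (upTo (suc D)) (λ i → *-distribʳ-boxSumZ D k (f ∘ (i ∷_)) r))
          (*-distribʳ-sumOver (upTo (suc D)) _ r)

  evalMulti : (D k : ℕ) → (Vec ℕ k → Z) → Vec Z k → Z
  evalMulti D k c t = boxSumZ D k (λ α → c α * monomialZ t α)

  evalMulti-cons : ∀ D k c u t →
    evalMulti D (suc k) c (u ∷ t) ≈ evalUni (upTo (suc D)) (λ i → evalMulti D k (c ∘ (i ∷_)) t) u
  evalMulti-cons D k c u t = sumOver-cong (upTo (suc D)) λ i →
    trans (boxSumZ-cong D k (λ α → x∙yz≈xz∙y (c (i ∷ α)) (u ^ i) (monomialZ t α)))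
          (*-distribʳ-boxSumZ D k _ (u ^ i))

  nonzero-coeff⇒exponents≤bound : ∀ {k n} (P : Poly₂ 𝒵 k n) {α β} →
    ¬ coeff P α β ≈ 0# → ∀ i → lookup α i ≤ bound P
  nonzero-coeff⇒exponents≤bound P {α} {β} c≉0 i =
    ≮⇒≥ (λ bound<αᵢ → c≉0 (vanish P α β (inj₁ (i , bound<αᵢ))))

  module Interpolation (dom : IsIntegralDomain 𝒵) {s : Z} (s≉0 : ¬ s ≈ 0#) (s∤1 : ¬ IsUnit 𝒵 s) where
    open IntegralDomain dom

    weight : List ℕ → ℕ → Z
    weight []       i = 1#
    weight (j ∷ js) i = (s ^ i - s ^ j) * weight js i

    weight-zero : ∀ {i js} → i ∈ js → weight js i ≈ 0#
    weight-zero (here ≡.refl) = trans (*-congʳ (-‿inverseʳ _)) (zeroˡ _)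
    weight-zero (there i∈js)  = trans (*-congˡ (weight-zero i∈js)) (zeroʳ _)

    weight-nonzero : ∀ i js → (∀ {j} → j ∈ js → j ≢ i) → ¬ weight js i ≈ 0#
    weight-nonzero i []       _   = proj₁ dom
    weight-nonzero i (j ∷ js) j≢i = *-nonzero sⁱ-sʲ≉0 (weight-nonzero i js (j≢i ∘ there))
      where
      sⁱ-sʲ≉0 : ¬ s ^ i - s ^ j ≈ 0#
      sⁱ-sʲ≉0 = j≢i (here ≡.refl) ∘ ≡.sym ∘ ^-injective s≉0 s∤1 i j ∘ x∙y⁻¹≈ε⇒x≈y _ _

    -- Each factor sⁱ - sʲ of the weight is produced by the operator f ↦ f(s u) - sʲ f(u).
    span-weighted : ∀ ns js a u → Span (evalUni ns a) (evalUni ns (λ i → a i * weight js i) u)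
    span-weighted ns []       a u = span-resp (evalUni-cong ns u (λ i → sym (*-identityʳ (a i)))) (gen u)
    span-weighted ns (j ∷ js) a u =
      span-resp (trans (evalUni-dilate ns b s u (- s ^ j)) (evalUni-cong ns u reassoc))
        (span-+ (span-weighted ns js a (s * u)) (span-* (- s ^ j) (span-weighted ns js a u)))
      where
      b : ℕ → Z
      b i = a i * weight js i
      reassoc : ∀ i → b i * (s ^ i - s ^ j) ≈ a i * weight (j ∷ js) i
      reassoc i = xy∙z≈x∙zy (a i) (weight js i) (s ^ i - s ^ j)

    coefficient-in-span₁ : ∀ D i₀ → i₀ ≤ D →
      ∃[ K ] (¬ K ≈ 0#) × (∀ a → Span (evalUni (upTo (suc D)) a) (K * a i₀))
    coefficient-in-span₁ D i₀ i₀≤D =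
      weight others i₀ , weight-nonzero i₀ others (proj₂ ∘ ∈-filter⁻ ≢i₀? {xs = nodes}) ,
      λ a → span-resp (isolate a) (span-weighted nodes others a 1#)
      where
      ≢i₀? : ∀ j → Dec (j ≢ i₀)
      ≢i₀? j = ¬? (j ≟ i₀)
      nodes others : List ℕ
      nodes  = upTo (suc D)
      others = filter ≢i₀? nodes
      isolate : ∀ a → evalUni nodes (λ i → a i * weight others i) 1# ≈ weight others i₀ * a i₀
      isolate a = trans
        (sumOver-single (upTo⁺ (suc D)) (∈-upTo⁺ (s≤s i₀≤D)) λ i∈nodes i≢i₀ →
          trans (*-congʳ (trans (*-congˡ (weight-zero (∈-filter⁺ ≢i₀? i∈nodes i≢i₀)))
                                (zeroʳ (a _))))
                (zeroˡ _))
        (trans (*-congˡ (1^n≈1 i₀)) (trans (*-identityʳ _) (*-comm _ _)))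

    coefficient-in-span : ∀ D k (α₀ : Vec ℕ k) → (∀ i → lookup α₀ i ≤ D) →
      ∃[ K ] (¬ K ≈ 0#) × (∀ c → Span (evalMulti D k c) (K * c α₀))
    coefficient-in-span D zero    []        _     = 1# , proj₁ dom , λ c → span-resp (*-comm _ _) (gen [])
    coefficient-in-span D (suc k) (i₀ ∷ α₀) α₀≤D
      with coefficient-in-span₁ D i₀ (α₀≤D fzero) | coefficient-in-span D k α₀ (α₀≤D ∘ fsuc)
    ... | K₁ , K₁≉0 , span₁ | K , K≉0 , spanₖ = K₁ * K , *-nonzero K₁≉0 K≉0 , Kc∈span
      where
      Kc∈span : ∀ c → Span (evalMulti D (suc k) c) (K₁ * K * c (i₀ ∷ α₀))
      Kc∈span c = span-resp (sym (*-assoc K₁ K _)) (span-minimal (span G ∶ K₁) fibre (spanₖ (c ∘ (i₀ ∷_))))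
        where
        G : Vec Z (suc k) → Z
        G = evalMulti D (suc k) c
        fibre : ∀ t → Span G (K₁ * evalMulti D k (c ∘ (i₀ ∷_)) t)
        fibre t = span-minimal (span G)
          (λ u → span-resp (evalMulti-cons D k c u t) (gen (u ∷ t)))
          (span₁ (λ i → evalMulti D k (c ∘ (i ∷_)) t))

  module LocalizationAt (φ : Z) where
    open Localization 𝒵 φ using (Loc; _+ₗ_; _*ₗ_; 0ₗ; ι; _^ₗ_; Dividesₗ; monomial; boxSum; specCoeff)

    infix 4 _≈ι_
    _≈ι_ : Loc → Z → Set ℓ
    (a , m) ≈ι z = (m ≡ 0) × (a ≈ z)

    ≈ι-+ : ∀ {x y a b} → x ≈ι a → y ≈ι b → x +ₗ y ≈ι a + b
    ≈ι-+ (≡.refl , x≈a) (≡.refl , y≈b) =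
      ≡.refl , +-cong (trans (*-identityʳ _) x≈a) (trans (*-identityʳ _) y≈b)

    ≈ι-* : ∀ {x y a b} → x ≈ι a → y ≈ι b → x *ₗ y ≈ι a * b
    ≈ι-* (≡.refl , x≈a) (≡.refl , y≈b) = ≡.refl , *-cong x≈a y≈b

    ≈ι-^ : ∀ {x a} → x ≈ι a → ∀ e → x ^ₗ e ≈ι a ^ e
    ≈ι-^ x≈a zero    = ≡.refl , refl
    ≈ι-^ x≈a (suc e) = ≈ι-* x≈a (≈ι-^ x≈a e)

    ≈ι-monomial : ∀ {k} (t : Vec Z k) α → monomial (Vec.map ι t) α ≈ι monomialZ t α
    ≈ι-monomial []       []       = ≡.refl , refl
    ≈ι-monomial (t ∷ ts) (e ∷ es) = ≈ι-* (≈ι-^ (≡.refl , refl) e) (≈ι-monomial ts es)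

    ≈ι-sumOver : ∀ ns {f g} → (∀ i → f i ≈ι g i) → foldr _+ₗ_ 0ₗ (map f ns) ≈ι sumOver ns g
    ≈ι-sumOver []       f≈g = ≡.refl , refl
    ≈ι-sumOver (i ∷ ns) f≈g = ≈ι-+ (f≈g i) (≈ι-sumOver ns f≈g)

    ≈ι-boxSum : ∀ D k {f g} → (∀ α → f α ≈ι g α) → boxSum D k f ≈ι boxSumZ D k g
    ≈ι-boxSum D zero    f≈g = f≈g []
    ≈ι-boxSum D (suc k) f≈g = ≈ι-sumOver (upTo (suc D)) (λ i → ≈ι-boxSum D k (f≈g ∘ (i ∷_)))

    ≈ι-specCoeff : ∀ {k n} (P : Poly₂ 𝒵 k n) t β →
      specCoeff P (Vec.map ι t) β ≈ι evalMulti (bound P) k (λ α → coeff P α β) t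
    ≈ι-specCoeff {k} P t β = ≈ι-boxSum (bound P) k (λ α → ≈ι-* (≡.refl , refl) (≈ι-monomial t α))

    -- The contraction to 𝒵 of the principal ideal (x) of 𝒵[1/φ]:
    -- x = a/φᵐ divides z/1 iff a ∣ z φᴺ for some N.
    contraction : Loc → Ideal 𝒵
    contraction (a , _) = record
      { member   = λ z → ∃[ N ] Divides 𝒵 a (z * φ ^ N)
      ; resp     = λ { x≈y (N , q , e) → N , q , trans (*-congʳ (sym x≈y)) e }
      ; zero∈    = 0 , 0# , trans (zeroˡ _) (sym (zeroˡ a))
      ; +-closed = +-closed′
      ; *-closed = λ { r (N , q , e) → N , r * q , trans (*-assoc r _ _) (trans (*-congˡ e) (sym (*-assoc r q a))) }
      }
      where
      +-closed′ : ∀ {x y} → ∃[ N ] Divides 𝒵 a (x * φ ^ N) → ∃[ N ] Divides 𝒵 a (y * φ ^ N) →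
                  ∃[ N ] Divides 𝒵 a ((x + y) * φ ^ N)
      +-closed′ {x} {y} (M , p , xφᴹ≈pa) (N , q , yφᴺ≈qa) = M ℕ.+ N , p * φ ^ N + q * φ ^ M , (begin
        (x + y) * φ ^ (M ℕ.+ N)                  ≈⟨ *-congˡ (^-homo-* φ M N) ⟩
        (x + y) * (φ ^ M * φ ^ N)                ≈⟨ expand x y (φ ^ M) (φ ^ N) ⟩
        x * φ ^ M * φ ^ N + y * φ ^ N * φ ^ M    ≈⟨ +-cong (*-congʳ xφᴹ≈pa) (*-congʳ yφᴺ≈qa) ⟩
        p * a * φ ^ N + q * a * φ ^ M            ≈⟨ collect p q a (φ ^ M) (φ ^ N) ⟩
        (p * φ ^ N + q * φ ^ M) * a              ∎)
        where
        expand : ∀ x y A B → (x + y) * (A * B) ≈ x * A * B + y * B * A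
        expand = solve 4 (λ x y A B → (x :+ y) :* (A :* B) := x :* A :* B :+ y :* B :* A) refl
        collect : ∀ p q a A B → p * a * B + q * a * A ≈ (p * B + q * A) * a
        collect = solve 5 (λ p q a A B → p :* a :* B :+ q :* a :* A := (p :* B :+ q :* A) :* a) refl

    Dividesₗ⇒∈contraction : ∀ {x y z} → Dividesₗ x y → y ≈ι z → member (contraction x) z
    Dividesₗ⇒∈contraction {a , m} {_ , _} {z} ((q , n) , y≈qx) (≡.refl , y≈z) = n ℕ.+ m , q , (begin
      z * φ ^ (n ℕ.+ m)        ≈⟨ *-cong (sym y≈z) (sym (^ᴿ≈^ φ (n ℕ.+ m))) ⟩
      _ * _^ᴿ_ 𝒵 φ (n ℕ.+ m)   ≈⟨ y≈qx ⟩
      q * a * 1#               ≈⟨ *-identityʳ _ ⟩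
      q * a                    ∎)

    fixed-divisor⇒values∈contraction : ∀ {k n} (P : Poly₂ 𝒵 k n) {x} →
      IsFixedDivisorPrincipal 𝒵 φ P x →
      ∀ β t → member (contraction x) (evalMulti (bound P) k (λ α → coeff P α β) t)
    fixed-divisor⇒values∈contraction P fixed β t =
      Dividesₗ⇒∈contraction (fixed (Vec.map ι t) β) (≈ι-specCoeff P t β)

    φ∈contraction⇒unit : ∀ x → member (contraction x) φ → IsUnitₗ 𝒵 φ x
    φ∈contraction⇒unit (a , m) (N , q , φᴺ⁺¹≈qa) = (q * φ ^ m , suc N) , (begin
      a * (q * φ ^ m) * 1#          ≈⟨ rearrange a q (φ ^ m) ⟩
      φ ^ m * (q * a)               ≈⟨ *-congˡ (sym φᴺ⁺¹≈qa) ⟩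
      φ ^ m * φ ^ suc N             ≈⟨ sym (^-homo-* φ m (suc N)) ⟩
      φ ^ (m ℕ.+ suc N)             ≈⟨ sym (^ᴿ≈^ φ (m ℕ.+ suc N)) ⟩
      _^ᴿ_ 𝒵 φ (m ℕ.+ suc N)        ≈⟨ sym (*-identityˡ _) ⟩
      1# * _^ᴿ_ 𝒵 φ (m ℕ.+ suc N)   ∎)
      where
      rearrange : ∀ a q A → a * (q * A) * 1# ≈ A * (q * a)
      rearrange = solve 3 (λ a q A → a :* (q :* A) :* con 1 := A :* (q :* a)) refl

proposition2p3 : ∀ {c ℓ : Level} (𝒵 : CommutativeRing c ℓ) →
    IsDedekindDomain 𝒵 ⊎ IsNearUFD 𝒵 →
    ∀ (k n : ℕ) (P : Poly₂ 𝒵 k n) → IsNonzeroPoly 𝒵 P →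
    ∃[ φ ] ((¬ CommutativeRing._≈_ 𝒵 φ (CommutativeRing.0# 𝒵)) ×
      (∀ x → ¬ IsUnitₗ 𝒵 φ x → ¬ IsFixedDivisorPrincipal 𝒵 φ P x))
proposition2p3 𝒵 hyp k n P (α₀ , β₀ , c≉0) with nonzero-nonunit 𝒵 hyp
... | dom , s , s≉0 , s∤1
    with Interpolation.coefficient-in-span 𝒵 dom s≉0 s∤1 (bound P) k α₀
           (nonzero-coeff⇒exponents≤bound 𝒵 P c≉0)
... | K , K≉0 , Kc∈span = φ , *-nonzero K≉0 c≉0 , no-fixed-divisor
  where
  open CommutativeRing 𝒵 using (Carrier; _*_)
  open IntegralDomain 𝒵 dom using (*-nonzero)
  φ : Carrier
  φ = K * coeff P α₀ β₀
  open LocalizationAt 𝒵 φ using (contraction; fixed-divisor⇒values∈contraction; φ∈contraction⇒unit)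
  no-fixed-divisor : ∀ x → ¬ IsUnitₗ 𝒵 φ x → ¬ IsFixedDivisorPrincipal 𝒵 φ P x
  no-fixed-divisor x nonunit fixed = nonunit (φ∈contraction⇒unit x φ∈⟨x⟩)
    where
    φ∈⟨x⟩ : member (contraction x) φ
    φ∈⟨x⟩ = span-minimal 𝒵 (contraction x)
      (fixed-divisor⇒values∈contraction P fixed β₀)
      (Kc∈span (λ α → coeff P α β₀))
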